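{- Let $\omega\in\Sigma^{\mathbb{N}}$ be strongly almost periodic, $\Sigma$ a finite alphabet, and let $a\in\Sigma$ occur in $\omega$. Then the $a$-split $s_a(\omega)$ is strongly almost periodic.
   Context: A sequence is strongly almost periodic if for every factor (nonempty finite string occurring in it) $x$ there is $l$ such that every factor of length $l$ contains an occurrence of $x$; in particular, if $a$ occurs in such $\omega$ it occurs infinitely often with bounded gaps. The $a$-split of $\omega$: cut $\omega$ immediately after each occurrence of $a$, writing $\omega$ as a concatenation $u_0u_1u_2\dots$ where $u_0\in(\Sigma\setminus\{a\})^*a$ and each block $u_k$ has the form $xa$ with $x\in(\Sigma\setminus\{a\})^*$. Since the gaps between occurrences of $a$ are bounded, only finitely many distinct blocks occur; encode them bijectively by the letters of a finite alphabet. The resulting sequence of codes, with its first symbol (the code of $u_0$) deleted, i.e. the coded sequence $u_1u_2u_3\dots$, is the $a$-split $s_a(\omega)$. For example, the $0$-split of $3200122403100110\dots$ is $(0)(12240)(310)(0)(110)\dots$. -}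

module Defs where

open import Data.Nat using (ℕ; zero; suc; _+_; _∸_; _≤_; _<_)
open import Data.List using (List; []; _∷_; length)
open import Data.Product using (Σ; ∃; _×_)
open import Relation.Binary.PropositionalEquality using (_≡_; _≢_)

window : {A : Set} → (ℕ → A) → ℕ → ℕ → List A
window ω i zero    = []
window ω i (suc n) = ω i ∷ window ω (suc i) n

OccursAt : {A : Set} → (ℕ → A) → List A → ℕ → Set
OccursAt ω x j = window ω j (length x) ≡ x

Factor : {A : Set} → (ℕ → A) → List A → Set
Factor ω x = (x ≢ []) × ∃ λ j → OccursAt ω x j

OccursInWindow : {A : Set} → (ℕ → A) → List A → ℕ → ℕ → Set
OccursInWindow ω x i l = ∃ λ j → (i ≤ j) × (j + length x ≤ i + l) × OccursAt ω x j

StronglyAlmostPeriodic : {A : Set} → (ℕ → A) → Set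
StronglyAlmostPeriodic ω =
  ∀ x → Factor ω x → ∃ λ l → ∀ i → OccursInWindow ω x i l

EnumeratesOccurrences : {A : Set} → (ℕ → A) → A → (ℕ → ℕ) → Set
EnumeratesOccurrences ω a p =
  (∀ k → p k < p (suc k)) ×
  (∀ k → ω (p k) ≡ a) ×
  (∀ i → ω i ≡ a → ∃ λ k → p k ≡ i)

-- the a-split, given the enumeration p of occurrences of a:
-- block k is u_{k+1} = ω(p k + 1) … ω(p (k+1)), i.e. x a with a ∉ x.
-- Blocks are represented by themselves (as elements of List A) instead of
-- by codes in a finite alphabet; the coding is a bijection on the finitely
-- many blocks occurring, so strong almost periodicity is unaffected.
split : {A : Set} → (ℕ → A) → (ℕ → ℕ) → ℕ → List A
split ω p k = window ω (suc (p k)) (p (suc k) ∸ p k)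

{-# OPTIONS --safe #-}
module Submission where

-- Let p enumerate the occurrences of a.  A run x of r consecutive blocks starting at
-- block j is spelled out by the factor w = ω(p j) … ω(p (j + r)) of ω, which begins
-- with an a.  Every occurrence of w in ω therefore starts at some occurrence p k of a,
-- and since the positions of a inside w are visible in w itself, the occurrences
-- p k, …, p (k + r) are spaced exactly like p j, …, p (j + r); hence blocks k, …,
-- k + r − 1 spell x as well.  A window of ω of length L starting at p i that contains
-- w thus yields an occurrence of x in the window of the split of length L starting
-- at i, as p is strictly increasing.

open import Data.Fin using (Fin) renaming (_≟_ to _≟ᶠ_)
open import Data.List using ([]; _∷_; length)
open import Data.List.Properties using (∷-injective)
open import Data.Nat using (ℕ; zero; suc; _+_; _∸_; _≤_; _<_; z≤n; z<s; s<s; s≤s⁻¹; _≤?_; _≤′_; ≤′-refl; ≤′-step)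
open import Data.Nat.Properties
open import Data.Product using (∃; _×_; _,_; proj₁; proj₂)
open import Data.Sum using (inj₁; inj₂)
open import Relation.Binary.Definitions using (DecidableEquality)
open import Relation.Binary.PropositionalEquality using (_≡_; _≢_; refl; sym; trans; cong; cong₂; subst; subst₂; module ≡-Reasoning)
open import Relation.Nullary using (¬_; Dec; yes; no; contradiction)
open import Relation.Nullary.Decidable using (_×-dec_)

open import Defs

private
  variable
    A : Set

least : {P : ℕ → Set} → (∀ n → Dec (P n)) → ∀ {n} → P n →
        ∃ λ m → P m × (∀ {k} → k < m → ¬ P k)
least P? pn with P? 0
... | yes p0 = 0 , p0 , λ ()
least     P? {zero}  pn | no ¬p0 = contradiction pn ¬p0
least {P} P? {suc n} pn | no ¬p0 with least (λ k → P? (suc k)) pn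
... | m , pm , below = suc m , pm , below′
  where
  below′ : ∀ {k} → k < suc m → ¬ P k
  below′ {zero}  _         = ¬p0
  below′ {suc k} (s<s k<m) = below k<m

module StrictlyIncreasing {f : ℕ → ℕ} (f-<-suc : ∀ n → f n < f (suc n)) where

  mono-< : ∀ {m n} → m < n → f m < f n
  mono-< {m} m<n = go (≤⇒≤′ m<n)
    where
    go : ∀ {n} → suc m ≤′ n → f m < f n
    go ≤′-refl      = f-<-suc m
    go (≤′-step le) = <-trans (go le) (f-<-suc _)

  mono-≤ : ∀ {m n} → m ≤ n → f m ≤ f n
  mono-≤ m≤n with m≤n⇒m<n∨m≡n m≤n
  ... | inj₁ m<n  = <⇒≤ (mono-< m<n)
  ... | inj₂ refl = ≤-refl

  cancel-≤ : ∀ {m n} → f m ≤ f n → m ≤ n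
  cancel-≤ fm≤fn = ≮⇒≥ (λ n<m → <⇒≱ (mono-< n<m) fm≤fn)

  cancel-< : ∀ {m n} → f m < f n → m < n
  cancel-< fm<fn = ≰⇒> (λ n≤m → <⇒≱ fm<fn (mono-≤ n≤m))

  n≤f[n] : ∀ n → n ≤ f n
  n≤f[n] zero    = z≤n
  n≤f[n] (suc n) = ≤-<-trans (n≤f[n] n) (f-<-suc n)

  d+f[m]≤f[d+m] : ∀ d m → d + f m ≤ f (d + m)
  d+f[m]≤f[d+m] zero    m = ≤-refl
  d+f[m]≤f[d+m] (suc d) m = ≤-<-trans (d+f[m]≤f[d+m] d m) (f-<-suc (d + m))

  f[n]≤f[m]+l⇒n≤m+l : ∀ {m n l} → m ≤ n → f n ≤ f m + l → n ≤ m + l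
  f[n]≤f[m]+l⇒n≤m+l {m} {n} {l} m≤n fn≤fm+l =
    subst (_≤ m + l) (m+[n∸m]≡n m≤n) (+-monoʳ-≤ m (+-cancelʳ-≤ (f m) (n ∸ m) l spread))
    where
    open ≤-Reasoning
    spread : n ∸ m + f m ≤ l + f m
    spread = begin
      n ∸ m + f m   ≤⟨ d+f[m]≤f[d+m] (n ∸ m) m ⟩
      f (n ∸ m + m) ≡⟨ cong f (m∸n+n≡m m≤n) ⟩
      f n           ≤⟨ fn≤fm+l ⟩
      f m + l       ≡⟨ +-comm (f m) l ⟩
      l + f m       ∎

window-length : (ω : ℕ → A) (i n : ℕ) → length (window ω i n) ≡ n
window-length ω i zero    = refl
window-length ω i (suc n) = cong suc (window-length ω (suc i) n)

window-factor : (ω : ℕ → A) (i n : ℕ) → Factor ω (window ω i (suc n))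
window-factor ω i n = (λ ()) , i , cong (window ω i) (window-length ω i (suc n))

-- Offsets are added on the left (d + u here, t + k for block indices below) so that
-- suc d + u reduces to suc (d + u).
AgreeOn : (ℕ → A) → ℕ → ℕ → ℕ → Set
AgreeOn ω n u v = ∀ {d} → d < n → ω (d + u) ≡ ω (d + v)

AgreeOn-suc : {ω : ℕ → A} {n u v : ℕ} → AgreeOn ω (suc n) u v → AgreeOn ω n (suc u) (suc v)
AgreeOn-suc {u = u} {v} agree {d} d<n rewrite +-suc d u | +-suc d v = agree (s<s d<n)

AgreeOn-shift : {ω : ℕ → A} {n u v o m : ℕ} → AgreeOn ω n u v → o + m ≤ n → AgreeOn ω m (o + u) (o + v)
AgreeOn-shift {n = n} {u} {v} {o} {m} agree o+m≤n {d} d<m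
  rewrite sym (+-assoc d o u) | sym (+-assoc d o v) =
  agree (<-≤-trans (+-monoˡ-< o d<m) (subst (_≤ n) (+-comm o m) o+m≤n))

window-cong : {ω : ℕ → A} {n u v : ℕ} → AgreeOn ω n u v → window ω u n ≡ window ω v n
window-cong {n = zero}  agree = refl
window-cong {ω = ω} {suc n} {u} {v} agree =
  cong₂ _∷_ (agree z<s) (window-cong (AgreeOn-suc {ω = ω} {n} {u} {v} agree))

window-≡⇒AgreeOn : {ω : ℕ → A} {n u v : ℕ} → window ω u n ≡ window ω v n → AgreeOn ω n u v
window-≡⇒AgreeOn {n = suc n} eq {zero} _ = proj₁ (∷-injective eq)
window-≡⇒AgreeOn {ω = ω} {suc n} {u} {v} eq {suc d} (s<s d<n)
  rewrite sym (+-suc d u) | sym (+-suc d v) =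
  window-≡⇒AgreeOn {ω = ω} {n} {suc u} {suc v} (proj₂ (∷-injective eq)) d<n

record FirstOccurrenceFrom {A : Set} (ω : ℕ → A) (a : A) (i y : ℕ) : Set where
  field
    from≤ : i ≤ y
    hit   : ω y ≡ a
    miss  : ∀ {z} → i ≤ z → z < y → ω z ≢ a

  only : ∀ {z} → i ≤ z → z ≤ y → ω z ≡ a → z ≡ y
  only i≤z z≤y ωz≡a with m≤n⇒m<n∨m≡n z≤y
  ... | inj₁ z<y = contradiction ωz≡a (miss i≤z z<y)
  ... | inj₂ z≡y = z≡y

open FirstOccurrenceFrom

FirstOccurrenceFrom-unique : {ω : ℕ → A} {a : A} {i y y′ : ℕ} →
  FirstOccurrenceFrom ω a i y → FirstOccurrenceFrom ω a i y′ → y ≡ y′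
FirstOccurrenceFrom-unique {y = y} {y′} first first′ with ≤-total y y′
... | inj₁ y≤y′ = only first′ (from≤ first) y≤y′ (hit first)
... | inj₂ y′≤y = sym (only first (from≤ first′) y′≤y (hit first′))

FirstOccurrenceFrom-transport : {ω : ℕ → A} {a : A} {n u v i y : ℕ} → AgreeOn ω n u v → y < n →
  FirstOccurrenceFrom ω a (i + v) (y + v) → FirstOccurrenceFrom ω a (i + u) (y + u)
FirstOccurrenceFrom-transport {ω = ω} {a} {u = u} {v} {i} {y} agree y<n first = record
  { from≤ = +-monoˡ-≤ u (+-cancelʳ-≤ v i y (from≤ first))
  ; hit   = trans (agree y<n) (hit first)
  ; miss  = miss′
  }
  where
  miss-offset : ∀ {e} → i ≤ e → e < y → ω (e + u) ≢ a
  miss-offset i≤e e<y ωe+u≡a =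
    miss first (+-monoˡ-≤ v i≤e) (+-monoˡ-< v e<y) (trans (sym (agree (<-trans e<y y<n))) ωe+u≡a)

  miss′ : ∀ {z} → i + u ≤ z → z < y + u → ω z ≢ a
  miss′ {z} i+u≤z z<y+u = subst (λ z → ω z ≢ a) (m∸n+n≡m u≤z) (miss-offset i≤z∸u z∸u<y)
    where
    u≤z : u ≤ z
    u≤z = m+n≤o⇒n≤o i i+u≤z
    i≤z∸u : i ≤ z ∸ u
    i≤z∸u = m+n≤o⇒m≤o∸n i i+u≤z
    z∸u<y : z ∸ u < y
    z∸u<y = +-cancelʳ-< u (z ∸ u) y (subst (_< y + u) (sym (m∸n+n≡m u≤z)) z<y+u)

firstOccurrenceFrom : {ω : ℕ → A} {a : A} → DecidableEquality A →
  (∀ i → ∃ λ j → i ≤ j × ω j ≡ a) → ∀ i → ∃ (FirstOccurrenceFrom ω a i)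
firstOccurrenceFrom {ω = ω} {a} _≟ᴬ_ recurrent i
  with least (λ j → (i ≤? j) ×-dec (ω j ≟ᴬ a)) (proj₂ (recurrent i))
... | y , (i≤y , ωy≡a) , below = y , record
  { from≤ = i≤y
  ; hit   = ωy≡a
  ; miss  = λ i≤z z<y ωz≡a → below z<y (i≤z , ωz≡a)
  }

module Enumeration {A : Set} {ω : ℕ → A} {a : A} (first : ∀ i → ∃ (FirstOccurrenceFrom ω a i)) where

  start : ℕ → ℕ
  occurrence : ℕ → ℕ
  occurrence k = proj₁ (first (start k))
  start zero    = zero
  start (suc k) = suc (occurrence k)

  occurrence-first : ∀ k → FirstOccurrenceFrom ω a (start k) (occurrence k)
  occurrence-first k = proj₂ (first (start k))

  occurrence-<-suc : ∀ k → occurrence k < occurrence (suc k)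
  occurrence-<-suc k = from≤ (occurrence-first (suc k))

  covers : ∀ k {i} → i ≤ occurrence k → ω i ≡ a → ∃ λ l → occurrence l ≡ i
  covers zero i≤ ωi≡a = zero , sym (only (occurrence-first zero) z≤n i≤ ωi≡a)
  covers (suc k) {i} i≤ ωi≡a with i ≤? occurrence k
  ... | yes i≤k = covers k i≤k ωi≡a
  ... | no  i≰k = suc k , sym (only (occurrence-first (suc k)) (≰⇒> i≰k) i≤ ωi≡a)

  enumerates : EnumeratesOccurrences ω a occurrence
  enumerates = occurrence-<-suc , (λ k → hit (occurrence-first k)) , λ i ωi≡a → covers i (n≤f[n] i) ωi≡a
    where open StrictlyIncreasing occurrence-<-suc

split-≡-window : (ω : ℕ → A) (p : ℕ → ℕ) {s u o₁ o₂ : ℕ} → p s ≡ o₁ + u → p (suc s) ≡ o₂ + u →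
                 split ω p s ≡ window ω (suc o₁ + u) (o₂ ∸ o₁)
split-≡-window ω p {u = u} {o₁} {o₂} eq₁ eq₂ =
  trans (cong₂ (λ x y → window ω (suc x) (y ∸ x)) eq₁ eq₂)
        (cong (window ω (suc o₁ + u))
              (trans (cong₂ _∸_ (+-comm o₂ u) (+-comm o₁ u)) ([m+n]∸[m+o]≡n∸o u o₂ o₁)))

stronglyAlmostPeriodic⇒recurrent : {ω : ℕ → A} {a : A} → StronglyAlmostPeriodic ω →
  (∃ λ i → ω i ≡ a) → ∀ i → ∃ λ j → i ≤ j × ω j ≡ a
stronglyAlmostPeriodic⇒recurrent {a = a} sap (i₀ , ωi₀≡a) i
  with proj₂ (sap (a ∷ []) ((λ ()) , i₀ , cong (_∷ []) ωi₀≡a)) i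
... | j , i≤j , _ , ωj∷[]≡a∷[] = j , i≤j , proj₁ (∷-injective ωj∷[]≡a∷[])

module _ {A : Set} {ω : ℕ → A} {a : A} {p : ℕ → ℕ} (E : EnumeratesOccurrences ω a p) where

  private
    p-<-suc : ∀ k → p k < p (suc k)
    p-<-suc = proj₁ E
    p-hit : ∀ k → ω (p k) ≡ a
    p-hit = proj₁ (proj₂ E)
    p-onto : ∀ i → ω i ≡ a → ∃ λ k → p k ≡ i
    p-onto = proj₂ (proj₂ E)

  open StrictlyIncreasing p-<-suc

  next-occurrence : ∀ s → FirstOccurrenceFrom ω a (suc (p s)) (p (suc s))
  next-occurrence s = record { from≤ = p-<-suc s ; hit = p-hit (suc s) ; miss = between }
    where
    between : ∀ {z} → suc (p s) ≤ z → z < p (suc s) → ω z ≢ a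
    between ps<z z<ps+1 ωz≡a with p-onto _ ωz≡a
    ... | m , refl = <⇒≱ (cancel-< ps<z) (s≤s⁻¹ (cancel-< z<ps+1))

  offset : ∀ {m n} → m ≤ n → ∃ λ o → p n ≡ o + p m
  offset m≤n = _ , sym (m∸n+n≡m (mono-≤ m≤n))

  module _ {k j n : ℕ} (agree : AgreeOn ω n (p k) (p j)) where

    occurrences-transport : ∀ t {o} → p (t + j) ≡ o + p j → o < n → p (t + k) ≡ o + p k
    occurrences-transport zero {o} eq _ rewrite +-cancelʳ-≡ (p j) o 0 (sym eq) = refl
    occurrences-transport (suc t) {o} eq o<n =
      FirstOccurrenceFrom-unique (next-occurrence (t + k)) transported
      where
      o₁ = proj₁ (offset (m≤n+m j t))
      eq₁ : p (t + j) ≡ o₁ + p j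
      eq₁ = proj₂ (offset (m≤n+m j t))
      o₁<o : o₁ < o
      o₁<o = +-cancelʳ-< (p j) o₁ o (subst₂ _<_ eq₁ eq (p-<-suc (t + j)))
      transported : FirstOccurrenceFrom ω a (suc (p (t + k))) (o + p k)
      transported rewrite occurrences-transport t eq₁ (<-trans o₁<o o<n) =
        FirstOccurrenceFrom-transport agree o<n
          (subst₂ (FirstOccurrenceFrom ω a) (cong suc eq₁) eq (next-occurrence (t + j)))

    blocks-transport : ∀ {t o₁ o₂} → p (t + j) ≡ o₁ + p j → p (suc t + j) ≡ o₂ + p j → o₂ < n →
                       split ω p (t + k) ≡ split ω p (t + j)
    blocks-transport {t} {o₁} {o₂} eq₁ eq₂ o₂<n = begin
      split ω p (t + k)                 ≡⟨ split-≡-window ω p {u = p k} (occurrences-transport t eq₁ o₁<n)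
                                                                      (occurrences-transport (suc t) eq₂ o₂<n) ⟩
      window ω (suc o₁ + p k) (o₂ ∸ o₁) ≡⟨ window-cong (AgreeOn-shift {ω = ω} agree fits) ⟩
      window ω (suc o₁ + p j) (o₂ ∸ o₁) ≡⟨ split-≡-window ω p {u = p j} eq₁ eq₂ ⟨
      split ω p (t + j)                 ∎
      where
      open ≡-Reasoning
      o₁<o₂ : o₁ < o₂
      o₁<o₂ = +-cancelʳ-< (p j) o₁ o₂ (subst₂ _<_ eq₁ eq₂ (p-<-suc (t + j)))
      o₁<n : o₁ < n
      o₁<n = <-trans o₁<o₂ o₂<n
      fits : suc o₁ + (o₂ ∸ o₁) ≤ n
      fits = subst (_≤ n) (cong suc (sym (m+[n∸m]≡n (<⇒≤ o₁<o₂)))) o₂<n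

    factor-transport : ∀ {r} → p (r + j) < n + p j → window (split ω p) k r ≡ window (split ω p) j r
    factor-transport {r} r+j<n+pj = window-cong blocks
      where
      blocks : AgreeOn (split ω p) r k j
      blocks {t} t<r = blocks-transport (proj₂ (offset (m≤n+m j t))) eq₂ o₂<n
        where
        o₂ = proj₁ (offset (m≤n+m j (suc t)))
        eq₂ : p (suc t + j) ≡ o₂ + p j
        eq₂ = proj₂ (offset (m≤n+m j (suc t)))
        o₂<n : o₂ < n
        o₂<n = +-cancelʳ-< (p j) o₂ n
                 (≤-<-trans (subst (_≤ p (r + j)) eq₂ (mono-≤ (+-monoˡ-≤ j t<r))) r+j<n+pj)

  split-stronglyAlmostPeriodic : StronglyAlmostPeriodic ω → StronglyAlmostPeriodic (split ω p)
  split-stronglyAlmostPeriodic sap x (_ , j , x-at-j) = L , occurs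
    where
    r = length x
    D = proj₁ (offset (m≤n+m j r))
    r+j≡D+pj : p (r + j) ≡ D + p j
    r+j≡D+pj = proj₂ (offset (m≤n+m j r))
    w = window ω (p j) (suc D)
    L = proj₁ (sap w (window-factor ω (p j) D))

    w-agree : ∀ {q} → OccursAt ω w q → AgreeOn ω (suc D) q (p j)
    w-agree {q} w-at-q =
      window-≡⇒AgreeOn (trans (cong (window ω q) (sym (window-length ω (p j) (suc D)))) w-at-q)

    occurs : ∀ i → OccursInWindow (split ω p) x i L
    occurs i with proj₂ (sap w (window-factor ω (p j) D)) (p i)
    ... | q , pi≤q , q+|w|≤pi+L , w-at-q with p-onto q (trans (w-agree w-at-q z<s) (p-hit j))
    ...   | k , refl = k , i≤k , f[n]≤f[m]+l⇒n≤m+l (≤-trans i≤k (m≤m+n k r)) bound , x-at-k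
      where
      agree : AgreeOn ω (suc D) (p k) (p j)
      agree = w-agree w-at-q
      i≤k : i ≤ k
      i≤k = cancel-≤ pi≤q
      x-at-k : OccursAt (split ω p) x k
      x-at-k = trans (factor-transport agree (subst (_< suc D + p j) (sym r+j≡D+pj) ≤-refl)) x-at-j
      open ≤-Reasoning
      bound : p (k + r) ≤ p i + L
      bound = begin
        p (k + r)      ≡⟨ cong p (+-comm k r) ⟩
        p (r + k)      ≡⟨ occurrences-transport agree r r+j≡D+pj ≤-refl ⟩
        D + p k        ≤⟨ n≤1+n _ ⟩
        suc D + p k    ≡⟨ +-comm (suc D) (p k) ⟩
        p k + suc D    ≡⟨ cong (p k +_) (window-length ω (p j) (suc D)) ⟨
        p k + length w ≤⟨ q+|w|≤pi+L ⟩
        p i + L        ∎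

lemma1 : (m : ℕ) (ω : ℕ → Fin m) (a : Fin m) →
         StronglyAlmostPeriodic ω →
         (∃ λ i → ω i ≡ a) →
         ∃ λ p → EnumeratesOccurrences ω a p × StronglyAlmostPeriodic (split ω p)
lemma1 m ω a sap a-occurs = occurrence , enumerates , split-stronglyAlmostPeriodic enumerates sap
  where
  open Enumeration (firstOccurrenceFrom _≟ᶠ_ (stronglyAlmostPeriodic⇒recurrent sap a-occurs))
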